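{- For every integer $k \geq 2$, with $n = 2k+1$, the number $\sigma(0, n)$ of $\sigma$-sequences of length $n$ with first term $a_1 = 0$ satisfies $\sigma(0, n) \geq 3$.
   Context: Let $k \geq 1$ and $n = 2k+1$. A $\sigma$-sequence of length $n$ is a sequence of integers $a_1 a_2 \dots a_n$ such that, with all indices taken cyclically modulo $n$: (i) $a_i \geq 0$; (ii) if $a_i = 0$ then $a_{i+(k+1)} = 1$; (iii) if $a_i = 1$ then $a_{i-1} = 0$ or $a_{i+k} = 0$; (iv) if $a_i > 1$ then $a_{i-1} = a_i - 1$; (v) there are at most three indices $i$ with $a_i = 0$. (Equivalently, every cyclic rotation of the sequence satisfies these conditions.) $\sigma(i, n)$ denotes the number of $\sigma$-sequences of length $n$ with $a_1 = i$. -}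

module Defs where

open import Data.Nat using (ℕ; zero; suc; _+_; _*_; _<_; _≤_; _∸_)
open import Data.Nat.DivMod using (_%_)
open import Data.Fin using (Fin; toℕ; fromℕ<)
open import Data.Nat.DivMod using (m%n<n)
open import Data.Vec using (Vec; lookup)
open import Data.List using (List; filter; length; allFin)
open import Data.Product using (_×_)
open import Data.Sum using (_⊎_)
open import Relation.Binary.PropositionalEquality using (_≡_)
open import Relation.Nullary using (¬_)
import Data.Nat.Properties as ℕₚ

-- Indices are 0-based: position i of the paper corresponds to index (i - 1).
-- Cyclic index arithmetic modulo n = 2k+1.
idx : (k : ℕ) → ℕ → Fin (suc (2 * k))
idx k m = fromℕ< (m%n<n m (suc (2 * k)))

at : (k : ℕ) → Vec ℕ (suc (2 * k)) → ℕ → ℕ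
at k a m = lookup a (idx k m)

-- Conditions (ii)-(iv) at index i (0-based).  i - 1 is taken as i + (n - 1).
Cond : (k : ℕ) → Vec ℕ (suc (2 * k)) → Fin (suc (2 * k)) → Set
Cond k a i =
  (at k a j ≡ 0 → at k a (j + suc k) ≡ 1) ×
  (at k a j ≡ 1 → (at k a (j + 2 * k) ≡ 0 ⊎ at k a (j + k) ≡ 0)) ×
  ((m : ℕ) → at k a j ≡ suc (suc m) → at k a (j + 2 * k) ≡ suc m)
  where j = toℕ i

zeros : {n : ℕ} → Vec ℕ n → ℕ
zeros {n} a = length (filter (λ i → lookup a i Data.Nat.≟ 0) (allFin n))
  where import Data.Nat

-- σ-sequence of length n = 2k+1 (condition (i) is automatic for ℕ entries).
IsSigmaSeq : (k : ℕ) → Vec ℕ (suc (2 * k)) → Set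
IsSigmaSeq k a = ((i : Fin (suc (2 * k))) → Cond k a i) × zeros a ≤ 3

-- We exhibit three explicit σ-sequences of length n = 2k+1 starting with 0:
--     0 | 1 2 … k       | 1 2 … k
--     0 | 0 1 … k-1     | 1 1 2 … k-1
--     0 | 1 1 2 … k-1   | 1 0 1 … k-2
-- Each has the "block form"  0 | A | B  with blocks A = gA 0 … gA (k-1) and
-- B = gB 0 … gB (k-1) of length k.  The point of this form is that the cyclic
-- offsets occurring in conditions (ii)–(iv) (k+1 forward, one back, k forward)
-- move A-entries to B-entries and back in an index-preserving way, so the
-- σ-conditions become simple local conditions on gA and gB (the record
-- BlockConditions).
module Submission where

open import Defs
open import Function using (_∘_)
open import Data.Nat using (ℕ; zero; suc; pred; _+_; _*_; _∸_; _≤_; _<_; _≟_; _<?_; z≤n; s≤s)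
open import Data.Nat.Properties
  using (≤-trans; ≤-refl; <-trans; n<1+n; m≤m+n; ≮⇒≥; m+[n∸m]≡n; m+n∸m≡n; +-identityʳ; +-monoʳ-<; m+n≮m; ∸-monoˡ-<)
open import Data.Nat.DivMod using (_%_; m%n<n; [m+n]%n≡m%n; m<n⇒m%n≡m)
open import Data.Nat.Tactic.RingSolver using (solve-∀)
open import Data.Fin using (Fin; zero; toℕ)
import Data.Fin as Fin
open import Data.Fin.Properties using (toℕ-fromℕ<; toℕ<n)
open import Data.Vec using (Vec; lookup; tabulate)
open import Data.Vec.Properties using (lookup∘tabulate)
open import Data.List using (List; []; _∷_; length; filter; map)
import Data.List as List
open import Data.List.Properties using (length-filter; filter-notAll; filter-accept; filter-reject; length-map)
open import Data.List.Membership.Propositional using (_∈_)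
open import Data.List.Membership.Propositional.Properties using (∈-filter⁺; ∈-map⁺)
open import Data.List.Relation.Unary.All using (All; []; _∷_)
open import Data.List.Relation.Unary.AllPairs using ([]; _∷_)
import Data.List.Relation.Unary.Any as Any
open import Data.List.Relation.Unary.Unique.Propositional using (Unique)
open import Data.Product using (Σ; _×_; _,_)
open import Data.Sum using (_⊎_; inj₁; inj₂)
open import Relation.Binary.PropositionalEquality using (_≡_; _≢_; refl; sym; trans; cong; subst)
open import Relation.Nullary using (Dec; yes; no; ¬_; ¬?; contradiction)

nonZero? : (j : ℕ) → Dec (¬ j ≡ 0)
nonZero? j = ¬? (j ≟ 0)

shiftDown : List ℕ → List ℕ
shiftDown ps = map pred (filter nonZero? ps)

length-shiftDown : ∀ ps → length (shiftDown ps) ≡ length (filter nonZero? ps)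
length-shiftDown ps = length-map pred (filter nonZero? ps)

zerosIn-shiftDown : ∀ {N n} (a : Vec ℕ N) (g : Fin (suc n) → Fin N) (ps : List ℕ) →
  (∀ i → lookup a (g i) ≡ 0 → toℕ i ∈ ps) →
  (∀ i → lookup a (g (Fin.suc i)) ≡ 0 → toℕ i ∈ shiftDown ps)
zerosIn-shiftDown a g ps zerosIn i isZero =
  ∈-map⁺ pred (∈-filter⁺ nonZero? (zerosIn (Fin.suc i) isZero) (λ ()))

zeros-bound : ∀ {N} (a : Vec ℕ N) n (g : Fin n → Fin N) (ps : List ℕ) →
  (∀ i → lookup a (g i) ≡ 0 → toℕ i ∈ ps) →
  length (filter (λ i → lookup a i ≟ 0) (List.tabulate g)) ≤ length ps
zeros-bound a zero g ps zerosIn = z≤n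
zeros-bound a (suc n) g ps zerosIn with lookup a (g Fin.zero) ≟ 0
... | yes g0≡0 rewrite filter-accept (λ i → lookup a i ≟ 0) {xs = List.tabulate (g ∘ Fin.suc)} g0≡0 =
  ≤-trans (s≤s (zeros-bound a n (g ∘ Fin.suc) (shiftDown ps) (zerosIn-shiftDown a g ps zerosIn)))
          (subst (_< length ps) (sym (length-shiftDown ps)) (filter-notAll nonZero? ps 0∈ps))
  where
  -- position 0 is listed, and it is exactly what shiftDown removes
  0∈ps : Any.Any (λ j → ¬ ¬ j ≡ 0) ps
  0∈ps = Any.map (λ 0≡j j≢0 → j≢0 (sym 0≡j)) (zerosIn Fin.zero g0≡0)
... | no g0≢0 rewrite filter-reject (λ i → lookup a i ≟ 0) {xs = List.tabulate (g ∘ Fin.suc)} g0≢0 =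
  ≤-trans (zeros-bound a n (g ∘ Fin.suc) (shiftDown ps) (zerosIn-shiftDown a g ps zerosIn))
          (subst (_≤ length ps) (sym (length-shiftDown ps)) (length-filter nonZero? ps))

zeros≤ : ∀ {n} (a : Vec ℕ n) (ps : List ℕ) → (∀ i → lookup a i ≡ 0 → toℕ i ∈ ps) → zeros a ≤ length ps
zeros≤ {n} a = zeros-bound a n (λ i → i)

blockAt : ℕ → (ℕ → ℕ) → (ℕ → ℕ) → ℕ → ℕ
blockAt k gA gB zero = 0
blockAt k gA gB (suc j) with j <? k
... | yes _ = gA j
... | no _  = gB (j ∸ k)

blockAt-A : ∀ k gA gB {t} → t < k → blockAt k gA gB (suc t) ≡ gA t
blockAt-A k gA gB {t} t<k with t <? k
... | yes _ = refl
... | no t≮k = contradiction t<k t≮k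

blockAt-B : ∀ k gA gB t → blockAt k gA gB (suc (k + t)) ≡ gB t
blockAt-B k gA gB t with k + t <? k
... | yes k+t<k = contradiction k+t<k (m+n≮m k t)
... | no _ = cong gB (m+n∸m≡n k t)

data Position (k : ℕ) : ℕ → Set where
  origin : Position k 0
  inA    : ∀ t → t < k → Position k (suc t)
  inB    : ∀ t → t < k → Position k (suc (k + t))

position : ∀ k j → j < suc (2 * k) → Position k j
position k zero    _          = origin
position k (suc j) (s≤s j<2k) with j <? k
... | yes j<k = inA j j<k
... | no j≮k  = subst (Position k) (cong suc (m+[n∸m]≡n k≤j)) (inB (j ∸ k) j∸k<k)
  where
  k≤j : k ≤ j
  k≤j = ≮⇒≥ j≮k
  j∸k<k : j ∸ k < k
  j∸k<k = subst (j ∸ k <_) (trans (m+n∸m≡n k (k + 0)) (+-identityʳ k)) (∸-monoˡ-< j<2k k≤j)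

-- The fields
-- zero-/one-/step-X are (ii)/(iii)/(iv) read inside block X, via the cyclic
-- neighbours  k+1 ahead (A t ↦ B (t+1), B t ↦ A t),  one back (X (t+1) ↦ X t) and
-- k ahead (A t ↦ B t, B (t+1) ↦ A t);  start-B is (ii) at the origin and start-A is
-- (iv) at A 0, whose predecessor is the origin.  All other instances of (ii)–(iv)
-- hold because the entry at the origin is 0.
record BlockConditions (k : ℕ) (gA gB : ℕ → ℕ) : Set where
  field
    start-B : gB 0 ≡ 1
    start-A : gA 0 ≤ 1
    zero-A  : ∀ t → t < k → gA t ≡ 0 → suc t < k × gB (suc t) ≡ 1
    one-A   : ∀ s → suc s < k → gA (suc s) ≡ 1 → gA s ≡ 0 ⊎ gB (suc s) ≡ 0
    step-A  : ∀ s m → suc s < k → gA (suc s) ≡ suc (suc m) → gA s ≡ suc m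
    zero-B  : ∀ t → t < k → gB t ≡ 0 → gA t ≡ 1
    one-B   : ∀ s → suc s < k → gB (suc s) ≡ 1 → gB s ≡ 0 ⊎ gA s ≡ 0
    step-B  : ∀ s m → suc s < k → gB (suc s) ≡ suc (suc m) → gB s ≡ suc m
    -- condition (v): besides position 0, zeros occur only at (at most two) listed positions
    otherZeros : List ℕ
    fewZeros   : length otherZeros ≤ 2
    zeros-A    : ∀ t → t < k → gA t ≡ 0 → suc t ∈ otherZeros
    zeros-B    : ∀ t → t < k → gB t ≡ 0 → suc (k + t) ∈ otherZeros

blockSequence : (k : ℕ) → (ℕ → ℕ) → (ℕ → ℕ) → Vec ℕ (suc (2 * k))
blockSequence k gA gB = tabulate (blockAt k gA gB ∘ toℕ)

CondAt : (k : ℕ) → Vec ℕ (suc (2 * k)) → ℕ → Set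
CondAt k a j =
  (at k a j ≡ 0 → at k a (j + suc k) ≡ 1) ×
  (at k a j ≡ 1 → (at k a (j + 2 * k) ≡ 0 ⊎ at k a (j + k) ≡ 0)) ×
  ((m : ℕ) → at k a j ≡ suc (suc m) → at k a (j + 2 * k) ≡ suc m)

ahead-of-A : ∀ t k → suc t + suc k ≡ suc (k + suc t)
ahead-of-A = solve-∀

ahead-of-B : ∀ k t → suc (k + t) + suc k ≡ suc t + suc (2 * k)
ahead-of-B = solve-∀

back-of-A : ∀ t k → suc t + 2 * k ≡ t + suc (2 * k)
back-of-A = solve-∀

back-of-B : ∀ k s → suc (k + suc s) + 2 * k ≡ suc (k + s) + suc (2 * k)
back-of-B = solve-∀

across-of-A : ∀ t k → suc t + k ≡ suc (k + t)
across-of-A = solve-∀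

across-of-B : ∀ k t → suc (k + t) + k ≡ t + suc (2 * k)
across-of-B = solve-∀

module BlockSequenceProperties {k : ℕ} {gA gB : ℕ → ℕ} (0<k : 0 < k) (c : BlockConditions k gA gB) where
  open BlockConditions c

  private
    n : ℕ
    n = suc (2 * k)
    f : ℕ → ℕ
    f = blockAt k gA gB
    a : Vec ℕ n
    a = blockSequence k gA gB

  at-mod : ∀ m → at k a m ≡ f (m % n)
  at-mod m = trans (lookup∘tabulate (f ∘ toℕ) (idx k m)) (cong f (toℕ-fromℕ< (m%n<n m n)))

  at-below : ∀ m → m < n → at k a m ≡ f m
  at-below m m<n = trans (at-mod m) (cong f (m<n⇒m%n≡m m<n))

  at-wrapped : ∀ x {m} → m ≡ x + n → x < n → at k a m ≡ f x
  at-wrapped x {m} m≡x+n x<n = trans (at-mod m)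
    (cong f (trans (cong (_% n) m≡x+n) (trans ([m+n]%n≡m%n x n) (m<n⇒m%n≡m x<n))))

  A-bound : ∀ {t} → t < k → suc t < n
  A-bound t<k = s≤s (≤-trans t<k (m≤m+n k (k + 0)))

  B-bound : ∀ {t} → t < k → suc (k + t) < n
  B-bound t<k = s≤s (+-monoʳ-< k (subst (_ <_) (sym (+-identityʳ k)) t<k))

  value-A : ∀ {t} → t < k → at k a (suc t) ≡ gA t
  value-A t<k = trans (at-below _ (A-bound t<k)) (blockAt-A k gA gB t<k)

  value-B : ∀ {t} → t < k → at k a (suc (k + t)) ≡ gB t
  value-B {t} t<k = trans (at-below _ (B-bound t<k)) (blockAt-B k gA gB t)

  below-n : ∀ {t} → t < k → t < n
  below-n t<k = <-trans (n<1+n _) (A-bound t<k)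

  ahead-A : ∀ {t} → suc t < k → at k a (suc t + suc k) ≡ gB (suc t)
  ahead-A {t} st<k = trans (cong (at k a) (ahead-of-A t k)) (value-B st<k)

  ahead-B : ∀ {t} → t < k → at k a (suc (k + t) + suc k) ≡ gA t
  ahead-B {t} t<k = trans (at-wrapped (suc t) (ahead-of-B k t) (A-bound t<k)) (blockAt-A k gA gB t<k)

  back-A : ∀ {t} → t < k → at k a (suc t + 2 * k) ≡ f t
  back-A {t} t<k = at-wrapped t (back-of-A t k) (below-n t<k)

  back-within-A : ∀ {s} → suc s < k → at k a (suc (suc s) + 2 * k) ≡ gA s
  back-within-A {s} ss<k = trans (back-A ss<k) (blockAt-A k gA gB (<-trans (n<1+n s) ss<k))

  back-B : ∀ {s} → suc s < k → at k a (suc (k + suc s) + 2 * k) ≡ gB s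
  back-B {s} ss<k = trans (at-wrapped (suc (k + s)) (back-of-B k s) (B-bound (<-trans (n<1+n s) ss<k)))
                          (blockAt-B k gA gB s)

  across-A : ∀ {t} → t < k → at k a (suc t + k) ≡ gB t
  across-A {t} t<k = trans (cong (at k a) (across-of-A t k)) (value-B t<k)

  across-B : ∀ {t} → t < k → at k a (suc (k + t) + k) ≡ f t
  across-B {t} t<k = at-wrapped t (across-of-B k t) (below-n t<k)

  across-B-to-A : ∀ {s} → suc s < k → at k a (suc (k + suc s) + k) ≡ gA s
  across-B-to-A {s} ss<k = trans (across-B ss<k) (blockAt-A k gA gB (<-trans (n<1+n s) ss<k))

  -- (ii)–(iv) at the origin: only (ii) has content, and it is  start-B.
  cond-origin : CondAt k a 0
  cond-origin = (λ _ → trans (cong (at k a) (cong suc (sym (+-identityʳ k)))) (trans (value-B 0<k) start-B))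
              , (λ a₀≡1 → contradiction (trans (sym a₀≡0) a₀≡1) (λ ()))
              , (λ m a₀≡m+2 → contradiction (trans (sym a₀≡0) a₀≡m+2) (λ ()))
    where
    a₀≡0 : at k a 0 ≡ 0
    a₀≡0 = at-below 0 (s≤s z≤n)

  cond-A : ∀ t → t < k → CondAt k a (suc t)
  cond-A t t<k = cond-zero , cond-one t t<k , cond-step t t<k
    where
    cond-zero : at k a (suc t) ≡ 0 → at k a (suc t + suc k) ≡ 1
    cond-zero a≡0 with zero-A t t<k (trans (sym (value-A t<k)) a≡0)
    ... | st<k , gB≡1 = trans (ahead-A st<k) gB≡1
    cond-one : ∀ t → t < k → at k a (suc t) ≡ 1 → at k a (suc t + 2 * k) ≡ 0 ⊎ at k a (suc t + k) ≡ 0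
    -- the origin precedes A 0
    cond-one zero    t<k _ = inj₁ (back-A t<k)
    cond-one (suc s) t<k a≡1 with one-A s t<k (trans (sym (value-A t<k)) a≡1)
    ... | inj₁ gA≡0 = inj₁ (trans (back-within-A t<k) gA≡0)
    ... | inj₂ gB≡0 = inj₂ (trans (across-A t<k) gB≡0)
    cond-step : ∀ t → t < k → (m : ℕ) → at k a (suc t) ≡ suc (suc m) → at k a (suc t + 2 * k) ≡ suc m
    -- the origin precedes A 0, so (iv) there is excluded by start-A
    cond-step zero    t<k m a≡m+2 = contradiction (subst (_≤ 1) (trans (sym (value-A t<k)) a≡m+2) start-A) (λ { (s≤s ()) })
    cond-step (suc s) t<k m a≡m+2 = trans (back-within-A t<k) (step-A s m t<k (trans (sym (value-A t<k)) a≡m+2))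

  cond-B : ∀ t → t < k → CondAt k a (suc (k + t))
  cond-B t t<k = cond-zero , cond-one t t<k , cond-step t t<k
    where
    cond-zero : at k a (suc (k + t)) ≡ 0 → at k a (suc (k + t) + suc k) ≡ 1
    cond-zero a≡0 = trans (ahead-B t<k) (zero-B t t<k (trans (sym (value-B t<k)) a≡0))
    cond-one : ∀ t → t < k → at k a (suc (k + t)) ≡ 1 → at k a (suc (k + t) + 2 * k) ≡ 0 ⊎ at k a (suc (k + t) + k) ≡ 0
    -- B 0 lies k before the origin
    cond-one zero    t<k _ = inj₂ (across-B t<k)
    cond-one (suc s) t<k a≡1 with one-B s t<k (trans (sym (value-B t<k)) a≡1)
    ... | inj₁ gB≡0 = inj₁ (trans (back-B t<k) gB≡0)
    ... | inj₂ gA≡0 = inj₂ (trans (across-B-to-A t<k) gA≡0)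
    cond-step : ∀ t → t < k → (m : ℕ) → at k a (suc (k + t)) ≡ suc (suc m) → at k a (suc (k + t) + 2 * k) ≡ suc m
    cond-step zero    t<k m a≡m+2 = contradiction (trans (sym start-B) (trans (sym (value-B t<k)) a≡m+2)) (λ ())
    cond-step (suc s) t<k m a≡m+2 = trans (back-B t<k) (step-B s m t<k (trans (sym (value-B t<k)) a≡m+2))

  cond : ∀ j → Position k j → CondAt k a j
  cond .0             origin      = cond-origin
  cond .(suc t)       (inA t t<k) = cond-A t t<k
  cond .(suc (k + t)) (inB t t<k) = cond-B t t<k

  zero-position : ∀ j → Position k j → f j ≡ 0 → j ∈ 0 ∷ otherZeros
  zero-position .0             origin      _   = Any.here refl
  zero-position .(suc t)       (inA t t<k) f≡0 = Any.there (zeros-A t t<k (trans (sym (blockAt-A k gA gB t<k)) f≡0))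
  zero-position .(suc (k + t)) (inB t t<k) f≡0 = Any.there (zeros-B t t<k (trans (sym (blockAt-B k gA gB t)) f≡0))

  isSigma : IsSigmaSeq k a
  isSigma = (λ i → cond (toℕ i) (positionOf i))
          , ≤-trans (zeros≤ a (0 ∷ otherZeros) zeroAt) (s≤s fewZeros)
    where
    positionOf : (i : Fin n) → Position k (toℕ i)
    positionOf i = position k (toℕ i) (toℕ<n i)
    zeroAt : ∀ i → lookup a i ≡ 0 → toℕ i ∈ 0 ∷ otherZeros
    zeroAt i a≡0 = zero-position (toℕ i) (positionOf i) (trans (sym (lookup∘tabulate (f ∘ toℕ) i)) a≡0)

blockSequence-isSigma : ∀ {k gA gB} → 0 < k → BlockConditions k gA gB → IsSigmaSeq k (blockSequence k gA gB)
blockSequence-isSigma 0<k c = BlockSequenceProperties.isSigma 0<k c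

blockSequence-starts-0 : ∀ k gA gB → lookup (blockSequence k gA gB) Fin.zero ≡ 0
blockSequence-starts-0 k gA gB = refl

oneThenId : ℕ → ℕ
oneThenId zero    = 1
oneThenId (suc t) = suc t

oneThenPred : ℕ → ℕ
oneThenPred zero    = 1
oneThenPred (suc t) = t

conditions₁ : ∀ k → BlockConditions k suc suc
conditions₁ k = record
  { start-B = refl ; start-A = ≤-refl
  ; zero-A = λ t _ () ; one-A = λ s _ () ; step-A = λ { s m _ refl → refl }
  ; zero-B = λ t _ () ; one-B = λ s _ () ; step-B = λ { s m _ refl → refl }
  ; otherZeros = [] ; fewZeros = z≤n ; zeros-A = λ t _ () ; zeros-B = λ t _ () }

conditions₂ : ∀ k → 2 ≤ k → BlockConditions k (λ t → t) oneThenId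
conditions₂ k 2≤k = record
  { start-B = refl ; start-A = z≤n
  ; zero-A = λ { zero _ refl → 2≤k , refl ; (suc t) _ () }
  ; one-A  = λ { zero _ refl → inj₁ refl ; (suc s) _ () }
  ; step-A = λ { (suc m) m _ refl → refl }
  ; zero-B = λ { zero _ () ; (suc t) _ () }
  ; one-B  = λ { zero _ refl → inj₂ refl ; (suc s) _ () }
  ; step-B = λ { (suc m) m _ refl → refl }
  ; otherZeros = 1 ∷ [] ; fewZeros = s≤s z≤n
  ; zeros-A = λ { zero _ refl → Any.here refl ; (suc t) _ () }
  ; zeros-B = λ { zero _ () ; (suc t) _ () } }

conditions₃ : ∀ k → BlockConditions k oneThenId oneThenPred
conditions₃ k = record
  { start-B = refl ; start-A = ≤-refl
  ; zero-A = λ { zero _ () ; (suc t) _ () }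
  ; one-A  = λ { zero _ refl → inj₂ refl ; (suc s) _ () }
  ; step-A = λ { (suc m) m _ refl → refl }
  ; zero-B = λ { (suc zero) _ refl → refl ; zero _ () ; (suc (suc t)) _ () }
  ; one-B  = λ { (suc zero) _ refl → inj₁ refl ; zero _ () ; (suc (suc s)) _ () }
  ; step-B = λ { (suc (suc m)) m _ refl → refl }
  ; otherZeros = suc (k + 1) ∷ [] ; fewZeros = s≤s z≤n
  ; zeros-A = λ { zero _ () ; (suc t) _ () }
  ; zeros-B = λ { (suc zero) _ refl → Any.here refl ; zero _ () ; (suc (suc t)) _ () } }

differAt : ∀ {n} {u v : Vec ℕ n} i → lookup u i ≢ lookup v i → u ≢ v
differAt i ui≢vi refl = ui≢vi refl

mainTheorem19 : (k : ℕ) → 2 ≤ k →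
    Σ (List (Vec ℕ (suc (2 * k)))) (λ L →
    (3 ≤ length L) × Unique L ×
    All (λ a → IsSigmaSeq k a × lookup a zero ≡ 0) L)
mainTheorem19 k@(suc (suc _)) 2≤k =
  (σ₁ ∷ σ₂ ∷ σ₃ ∷ []) , ≤-refl ,
  ((σ₁≢σ₂ ∷ σ₁≢σ₃ ∷ []) ∷ (σ₂≢σ₃ ∷ []) ∷ [] ∷ []) ,
  (starts0 (conditions₁ k) ∷ starts0 (conditions₂ k 2≤k) ∷ starts0 (conditions₃ k) ∷ [])
  where
  σ₁ σ₂ σ₃ : Vec ℕ (suc (2 * k))
  σ₁ = blockSequence k suc suc
  σ₂ = blockSequence k (λ t → t) oneThenId
  σ₃ = blockSequence k oneThenId oneThenPred
  starts0 : ∀ {gA gB} → BlockConditions k gA gB → IsSigmaSeq k (blockSequence k gA gB) × lookup (blockSequence k gA gB) zero ≡ 0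
  starts0 {gA} {gB} c = blockSequence-isSigma (s≤s z≤n) c , blockSequence-starts-0 k gA gB
  -- σ₁, σ₂, σ₃ have second entries 1, 0, 1 and third entries 2, 1, 1
  σ₁≢σ₂ : σ₁ ≢ σ₂
  σ₁≢σ₂ = differAt (Fin.suc zero) (λ ())
  σ₁≢σ₃ : σ₁ ≢ σ₃
  σ₁≢σ₃ = differAt (Fin.suc (Fin.suc zero)) (λ ())
  σ₂≢σ₃ : σ₂ ≢ σ₃
  σ₂≢σ₃ = differAt (Fin.suc zero) (λ ())
mainTheorem19 zero       ()
mainTheorem19 (suc zero) (s≤s ())
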